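{- The rule $(\forall_{r1})$ is invertible in $\mathsf{LNIF}$: if $\mathcal{G}/\!/\Gamma\vdash\Delta,\forall xA$ is derivable in $\mathsf{LNIF}$ (where $\Gamma\vdash\Delta,\forall xA$ is the last component) and $a$ is a parameter not occurring in it, then $\mathcal{G}/\!/\Gamma\vdash\Delta/\!/\ \vdash A[a/x]$ is derivable in $\mathsf{LNIF}$.
   Context: Formulae are first-order over $\bot,\land,\lor,\supset,\forall,\exists$; in sequents bound variables $x,y,\dots$ are distinct from parameters $a,b,\dots$, which occupy all free positions; $A[a/x]$ replaces free occurrences of $x$ by $a$; $p(\vec a)$ is an atomic formula with parameters $\vec a$. A linear nested sequent is $\Gamma_1\vdash\Delta_1 /\!/ \cdots /\!/ \Gamma_n\vdash\Delta_n$ ($n\ge1$), each $\Gamma_i,\Delta_i$ a finite, possibly empty, multiset of formulae (a component). In rule schemas, $\mathcal{G},\mathcal{H},\mathcal{F}$ denote possibly empty sequences of components. $\mathsf{LNIF}$ has the rules (from premise(s) infer conclusion): Initial: $(id_1)$ $\mathcal{G}/\!/\Gamma,p(\vec a)\vdash p(\vec a),\Delta/\!/\mathcal{H}$; $(id_2)$ $\mathcal{G}/\!/\Gamma_1,p(\vec a)\vdash\Delta_1/\!/\mathcal{H}/\!/\Gamma_2\vdash p(\vec a),\Delta_2/\!/\mathcal{F}$; $(\bot_l)$ $\mathcal{G}/\!/\Gamma,\bot\vdash\Delta/\!/\mathcal{H}$. $(\land_l)$: from $\mathcal{G}/\!/\Gamma,A,B\vdash\Delta/\!/\mathcal{H}$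 infer $\mathcal{G}/\!/\Gamma,A\land B\vdash\Delta/\!/\mathcal{H}$. $(\lor_r)$: from $\mathcal{G}/\!/\Gamma\vdash\Delta,A,B/\!/\mathcal{H}$ infer $\mathcal{G}/\!/\Gamma\vdash\Delta,A\lor B/\!/\mathcal{H}$. $(\land_r)$: from $\mathcal{G}/\!/\Gamma\vdash\Delta,A/\!/\mathcal{H}$ and $\mathcal{G}/\!/\Gamma\vdash\Delta,B/\!/\mathcal{H}$ infer $\mathcal{G}/\!/\Gamma\vdash\Delta,A\land B/\!/\mathcal{H}$. $(\lor_l)$: from $\mathcal{G}/\!/\Gamma,A\vdash\Delta/\!/\mathcal{H}$ and $\mathcal{G}/\!/\Gamma,B\vdash\Delta/\!/\mathcal{H}$ infer $\mathcal{G}/\!/\Gamma,A\lor B\vdash\Delta/\!/\mathcal{H}$. $(\supset_{r1})$: from $\mathcal{G}/\!/\Gamma\vdash\Delta/\!/A\vdash B$ infer $\mathcal{G}/\!/\Gamma\vdash\Delta,A\supset B$. $(\supset_l)$: from $\mathcal{G}/\!/\Gamma,B\vdash\Delta/\!/\mathcal{H}$ and $\mathcal{G}/\!/\Gamma,A\supset B\vdash A,\Delta/\!/\mathcal{H}$ infer $\mathcal{G}/\!/\Gamma,A\supset B\vdash\Delta/\!/\mathcal{H}$. $(lift)$: from $\mathcal{G}/\!/\Gamma_1,A\vdash\Delta_1/\!/\Gamma_2,A\vdash\Delta_2/\!/\mathcal{H}$ infer $\mathcal{G}/\!/\Gamma_1,A\vdash\Delta_1/\!/\Gamma_2\vdash\Delta_2/\!/\mathcal{H}$.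 $(\forall_l)$: from $\mathcal{G}/\!/\Gamma,A[a/x],\forall xA\vdash\Delta/\!/\mathcal{H}$ infer $\mathcal{G}/\!/\Gamma,\forall xA\vdash\Delta/\!/\mathcal{H}$ ($a$ any parameter). $(\forall_{r1})$: from $\mathcal{G}/\!/\Gamma\vdash\Delta/\!/\ \vdash A[a/x]$ infer $\mathcal{G}/\!/\Gamma\vdash\Delta,\forall xA$. $(\exists_l)$: from $\mathcal{G}/\!/\Gamma,A[a/x]\vdash\Delta/\!/\mathcal{H}$ infer $\mathcal{G}/\!/\Gamma,\exists xA\vdash\Delta/\!/\mathcal{H}$. $(\exists_r)$: from $\mathcal{G}/\!/\Gamma\vdash A[a/x],\exists xA,\Delta/\!/\mathcal{H}$ infer $\mathcal{G}/\!/\Gamma\vdash\exists xA,\Delta/\!/\mathcal{H}$ ($a$ any parameter). $(\supset_{r2})$: from $\mathcal{G}/\!/\Gamma_1\vdash\Delta_1/\!/A\vdash B/\!/\Gamma_2\vdash\Delta_2/\!/\mathcal{H}$ and $\mathcal{G}/\!/\Gamma_1\vdash\Delta_1/\!/\Gamma_2\vdash\Delta_2,A\supset B/\!/\mathcal{H}$ infer $\mathcal{G}/\!/\Gamma_1\vdash\Delta_1,A\supset B/\!/\Gamma_2\vdash\Delta_2/\!/\mathcal{H}$. $(\forall_{r2})$: from $\mathcal{G}/\!/\Gamma_1\vdash\Delta_1/\!/\ \vdash A[a/x]/\!/\Gamma_2\vdash\Delta_2/\!/\mathcal{H}$ and $\mathcal{G}/\!/\Gamma_1\vdash\Delta_1/\!/\Gamma_2\vdash\Delta_2,\forall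 xA/\!/\mathcal{H}$ infer $\mathcal{G}/\!/\Gamma_1\vdash\Delta_1,\forall xA/\!/\Gamma_2\vdash\Delta_2/\!/\mathcal{H}$. In $(\forall_{r1}),(\exists_l),(\forall_{r2})$, $a$ is an eigenvariable (does not occur in the conclusion). -}

module Defs where

open import Data.Nat using (ℕ; _≟_)
open import Data.List using (List; []; _∷_; _++_; concatMap)
open import Data.List.Membership.Propositional using (_∈_; _∉_)
open import Data.List.Relation.Binary.Permutation.Propositional using (_↭_)
open import Data.List.Relation.Binary.Pointwise using (Pointwise)
open import Data.Product using (_×_)
open import Data.Unit using (⊤)
open import Relation.Nullary using (yes; no)

-- Bound variables and parameters are both named by natural numbers,
-- but they live in syntactically distinct classes.
BVar : Set
BVar = ℕ

Param : Set
Param = ℕ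

data Term : Set where
  var : BVar → Term
  par : Param → Term

infixr 6 _∧'_
infixr 5 _∨'_
infixr 4 _⊃_
data Formula : Set where
  ⊥'    : Formula
  atom  : ℕ → List Term → Formula
  _∧'_  : Formula → Formula → Formula
  _∨'_  : Formula → Formula → Formula
  _⊃_   : Formula → Formula → Formula
  all   : BVar → Formula → Formula
  ex    : BVar → Formula → Formula

substT : Term → Param → BVar → Term
substT (var y) a x with y ≟ x
... | yes _ = par a
... | no  _ = var y
substT (par b) a x = par b

_[_/_] : Formula → Param → BVar → Formula
⊥' [ a / x ] = ⊥'
atom p ts [ a / x ] = atom p (substTs ts)
  where
  substTs : List Term → List Term
  substTs [] = []
  substTs (t ∷ ts') = substT t a x ∷ substTs ts'
(A ∧' B) [ a / x ] = (A [ a / x ]) ∧' (B [ a / x ])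
(A ∨' B) [ a / x ] = (A [ a / x ]) ∨' (B [ a / x ])
(A ⊃ B) [ a / x ] = (A [ a / x ]) ⊃ (B [ a / x ])
all y A [ a / x ] with y ≟ x
... | yes _ = all y A
... | no  _ = all y (A [ a / x ])
ex y A [ a / x ] with y ≟ x
... | yes _ = ex y A
... | no  _ = ex y (A [ a / x ])

paramsT : Term → List Param
paramsT (var _) = []
paramsT (par a) = a ∷ []

paramsF : Formula → List Param
paramsF ⊥' = []
paramsF (atom p ts) = concatMap paramsT ts
paramsF (A ∧' B) = paramsF A ++ paramsF B
paramsF (A ∨' B) = paramsF A ++ paramsF B
paramsF (A ⊃ B) = paramsF A ++ paramsF B
paramsF (all _ A) = paramsF A
paramsF (ex _ A) = paramsF A

-- Closedness: every bound variable occurrence is bound (parameters occupy all free positions)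
ClosedT : List BVar → Term → Set
ClosedT ctx (var x) = x ∈ ctx
ClosedT ctx (par _) = ⊤

ClosedTs : List BVar → List Term → Set
ClosedTs ctx [] = ⊤
ClosedTs ctx (t ∷ ts) = ClosedT ctx t × ClosedTs ctx ts

ClosedUnder : List BVar → Formula → Set
ClosedUnder ctx ⊥' = ⊤
ClosedUnder ctx (atom p ts) = ClosedTs ctx ts
ClosedUnder ctx (A ∧' B) = ClosedUnder ctx A × ClosedUnder ctx B
ClosedUnder ctx (A ∨' B) = ClosedUnder ctx A × ClosedUnder ctx B
ClosedUnder ctx (A ⊃ B) = ClosedUnder ctx A × ClosedUnder ctx B
ClosedUnder ctx (all x A) = ClosedUnder (x ∷ ctx) A
ClosedUnder ctx (ex x A) = ClosedUnder (x ∷ ctx) A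

ClosedL : List Formula → Set
ClosedL [] = ⊤
ClosedL (A ∷ Γ) = ClosedUnder [] A × ClosedL Γ

-- Components Γ ⊢ Δ (multisets represented as lists, identified up to permutation)
infix 3 _⊢_
data Component : Set where
  _⊢_ : List Formula → List Formula → Component

-- Linear nested sequent: a (nonempty, in derivable cases) list of components, separated by //
LNS : Set
LNS = List Component

paramsC : Component → List Param
paramsC (Γ ⊢ Δ) = concatMap paramsF Γ ++ concatMap paramsF Δ

paramsS : LNS → List Param
paramsS = concatMap paramsC

ClosedC : Component → Set
ClosedC (Γ ⊢ Δ) = ClosedL Γ × ClosedL Δ

ClosedS : LNS → Set
ClosedS [] = ⊤
ClosedS (c ∷ cs) = ClosedC c × ClosedS cs

_≈C_ : Component → Component → Set
(Γ ⊢ Δ) ≈C (Γ' ⊢ Δ') = (Γ ↭ Γ') × (Δ ↭ Δ')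

_≈S_ : LNS → LNS → Set
_≈S_ = Pointwise _≈C_

-- Principal formulae are written at the head of
-- a component; the constructor 'perm' makes derivability respect
-- multiset equality of components (components are multisets).
data LNIF : LNS → Set where
  perm : ∀ {S S'} → S ≈S S' → LNIF S → LNIF S'
  id₁ : ∀ G H Γ Δ p ts → LNIF (G ++ (atom p ts ∷ Γ ⊢ atom p ts ∷ Δ) ∷ H)
  id₂ : ∀ G H F Γ₁ Δ₁ Γ₂ Δ₂ p ts →
        LNIF (G ++ (atom p ts ∷ Γ₁ ⊢ Δ₁) ∷ H ++ (Γ₂ ⊢ atom p ts ∷ Δ₂) ∷ F)
  ⊥l  : ∀ G H Γ Δ → LNIF (G ++ (⊥' ∷ Γ ⊢ Δ) ∷ H)
  ∧l  : ∀ G H Γ Δ A B → LNIF (G ++ (A ∷ B ∷ Γ ⊢ Δ) ∷ H) →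
        LNIF (G ++ ((A ∧' B) ∷ Γ ⊢ Δ) ∷ H)
  ∨r  : ∀ G H Γ Δ A B → LNIF (G ++ (Γ ⊢ A ∷ B ∷ Δ) ∷ H) →
        LNIF (G ++ (Γ ⊢ (A ∨' B) ∷ Δ) ∷ H)
  ∧r  : ∀ G H Γ Δ A B → LNIF (G ++ (Γ ⊢ A ∷ Δ) ∷ H) → LNIF (G ++ (Γ ⊢ B ∷ Δ) ∷ H) →
        LNIF (G ++ (Γ ⊢ (A ∧' B) ∷ Δ) ∷ H)
  ∨l  : ∀ G H Γ Δ A B → LNIF (G ++ (A ∷ Γ ⊢ Δ) ∷ H) → LNIF (G ++ (B ∷ Γ ⊢ Δ) ∷ H) →
        LNIF (G ++ ((A ∨' B) ∷ Γ ⊢ Δ) ∷ H)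
  ⊃r₁ : ∀ G Γ Δ A B → LNIF (G ++ (Γ ⊢ Δ) ∷ (A ∷ [] ⊢ B ∷ []) ∷ []) →
        LNIF (G ++ (Γ ⊢ (A ⊃ B) ∷ Δ) ∷ [])
  ⊃l  : ∀ G H Γ Δ A B → LNIF (G ++ (B ∷ Γ ⊢ Δ) ∷ H) →
        LNIF (G ++ ((A ⊃ B) ∷ Γ ⊢ A ∷ Δ) ∷ H) →
        LNIF (G ++ ((A ⊃ B) ∷ Γ ⊢ Δ) ∷ H)
  lift : ∀ G H Γ₁ Δ₁ Γ₂ Δ₂ A → LNIF (G ++ (A ∷ Γ₁ ⊢ Δ₁) ∷ (A ∷ Γ₂ ⊢ Δ₂) ∷ H) →
         LNIF (G ++ (A ∷ Γ₁ ⊢ Δ₁) ∷ (Γ₂ ⊢ Δ₂) ∷ H)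
  ∀l  : ∀ G H Γ Δ x A (a : Param) → LNIF (G ++ (A [ a / x ] ∷ all x A ∷ Γ ⊢ Δ) ∷ H) →
        LNIF (G ++ (all x A ∷ Γ ⊢ Δ) ∷ H)
  ∀r₁ : ∀ G Γ Δ x A (a : Param) →
        a ∉ paramsS (G ++ (Γ ⊢ all x A ∷ Δ) ∷ []) →
        LNIF (G ++ (Γ ⊢ Δ) ∷ ([] ⊢ A [ a / x ] ∷ []) ∷ []) →
        LNIF (G ++ (Γ ⊢ all x A ∷ Δ) ∷ [])
  ∃l  : ∀ G H Γ Δ x A (a : Param) →
        a ∉ paramsS (G ++ (ex x A ∷ Γ ⊢ Δ) ∷ H) →
        LNIF (G ++ (A [ a / x ] ∷ Γ ⊢ Δ) ∷ H) →
        LNIF (G ++ (ex x A ∷ Γ ⊢ Δ) ∷ H)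
  ∃r  : ∀ G H Γ Δ x A (a : Param) → LNIF (G ++ (Γ ⊢ A [ a / x ] ∷ ex x A ∷ Δ) ∷ H) →
        LNIF (G ++ (Γ ⊢ ex x A ∷ Δ) ∷ H)
  ⊃r₂ : ∀ G H Γ₁ Δ₁ Γ₂ Δ₂ A B →
        LNIF (G ++ (Γ₁ ⊢ Δ₁) ∷ (A ∷ [] ⊢ B ∷ []) ∷ (Γ₂ ⊢ Δ₂) ∷ H) →
        LNIF (G ++ (Γ₁ ⊢ Δ₁) ∷ (Γ₂ ⊢ (A ⊃ B) ∷ Δ₂) ∷ H) →
        LNIF (G ++ (Γ₁ ⊢ (A ⊃ B) ∷ Δ₁) ∷ (Γ₂ ⊢ Δ₂) ∷ H)
  ∀r₂ : ∀ G H Γ₁ Δ₁ Γ₂ Δ₂ x A (a : Param) →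
        a ∉ paramsS (G ++ (Γ₁ ⊢ all x A ∷ Δ₁) ∷ (Γ₂ ⊢ Δ₂) ∷ H) →
        LNIF (G ++ (Γ₁ ⊢ Δ₁) ∷ ([] ⊢ A [ a / x ] ∷ []) ∷ (Γ₂ ⊢ Δ₂) ∷ H) →
        LNIF (G ++ (Γ₁ ⊢ Δ₁) ∷ (Γ₂ ⊢ all x A ∷ Δ₂) ∷ H) →
        LNIF (G ++ (Γ₁ ⊢ all x A ∷ Δ₁) ∷ (Γ₂ ⊢ Δ₂) ∷ H)

-- Invertibility is proved together with weakening and parameter renaming, by induction on the
-- derivation.  An image of a sequent S under a parameter renaming σ maps the components of S, in
-- order, into components containing their σ-images; further components may be inserted, and one
-- formula ∀yB may be omitted from a component provided a later inserted component (the witness)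
-- has σB[b/y] in its succedent.  Every image of a derivable sequent is derivable: each rule is
-- replayed on the image, with eigenvariables renamed to parameters fresh for the image and the
-- rules relating neighbouring components (⊃r, ∀r, lift) iterated across the inserted ones.  When
-- the omitted ∀yB is principal, the premise is used with the eigenvariable renamed to b and the
-- new component mapped onto the witness, unless ∀r₂ first moves ∀yB into a component preceding
-- the witness, in which case the omission moves with it.  The theorem is the image of
-- G // Γ ⊢ ∀xA, Δ that omits ∀xA and appends the witness ⊢ A[a/x].

module Submission where

open import Defs
open import Data.Nat using (ℕ; suc; _≤_; z≤n; s≤s; _≟_)
open import Data.Nat.ListAction using (sum)
open import Data.Nat.Properties using (m≤m+n; m≤n+m; n≮n; ≤-refl; ≤-trans; n≤1+n)
open import Data.List using (List; []; _∷_; _++_; map; concatMap)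
open import Data.List.Properties using (map-cong; map-id; map-++; ++-assoc; ++-identityʳ)
open import Data.List.Membership.Propositional using (_∈_; _∉_)
open import Data.List.Membership.Propositional.Properties using (∈-++⁺ˡ; ∈-++⁺ʳ; ∈-concatMap⁺; ∈-∃++)
open import Data.List.Relation.Unary.Any using (here; there)
open import Data.List.Relation.Unary.All as All using (All; []; _∷_)
open import Data.List.Relation.Unary.All.Properties using (¬Any⇒All¬; ++⁻)
open import Data.List.Relation.Binary.Permutation.Propositional using (_↭_; prep; swap; ↭-refl; ↭-reflexive; ↭-sym; ↭-trans)
open import Data.List.Relation.Binary.Permutation.Propositional.Properties using (++⁺ˡ; ++⁺ʳ; map⁺; shift; drop-∷; ∈-resp-↭; All-resp-↭)
open import Data.List.Relation.Binary.Pointwise as Pointwise using ([]; _∷_)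
open import Data.Sum using (_⊎_; inj₁; inj₂)
open import Data.Product using (_×_; _,_; ∃)
open import Function using (id; _∘_)
open import Relation.Nullary using (yes; no; contradiction)
open import Relation.Binary.PropositionalEquality using (_≡_; _≢_; refl; sym; trans; cong; cong₂; subst; module ≡-Reasoning)

Renaming : Set
Renaming = Param → Param

renameᵗ : Renaming → Term → Term
renameᵗ σ (var y) = var y
renameᵗ σ (par b) = par (σ b)

rename : Renaming → Formula → Formula
rename σ ⊥' = ⊥'
rename σ (atom p ts) = atom p (map (renameᵗ σ) ts)
rename σ (A ∧' B) = rename σ A ∧' rename σ B
rename σ (A ∨' B) = rename σ A ∨' rename σ B
rename σ (A ⊃ B) = rename σ A ⊃ rename σ B
rename σ (all y A) = all y (rename σ A)
rename σ (ex y A) = ex y (rename σ A)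

renameᴸ : Renaming → List Formula → List Formula
renameᴸ σ = map (rename σ)

atom-injective : ∀ {p q ts us} → atom p ts ≡ atom q us → ts ≡ us
atom-injective refl = refl

renameᵗ-substT : ∀ σ t b y → renameᵗ σ (substT t b y) ≡ substT (renameᵗ σ t) (σ b) y
renameᵗ-substT σ (var z) b y with z ≟ y
... | yes _ = refl
... | no _ = refl
renameᵗ-substT σ (par c) b y = refl

-- Defs substitutes inside atoms by a local function, so atoms are handled
-- by recursion on the argument list through the atom itself.
rename-[/] : ∀ σ A b y → rename σ (A [ b / y ]) ≡ rename σ A [ σ b / y ]
rename-[/] σ ⊥' b y = refl
rename-[/] σ (atom p []) b y = refl
rename-[/] σ (atom p (t ∷ ts)) b y =
  cong₂ (λ u us → atom p (u ∷ us)) (renameᵗ-substT σ t b y)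
        (atom-injective (rename-[/] σ (atom p ts) b y))
rename-[/] σ (A ∧' B) b y = cong₂ _∧'_ (rename-[/] σ A b y) (rename-[/] σ B b y)
rename-[/] σ (A ∨' B) b y = cong₂ _∨'_ (rename-[/] σ A b y) (rename-[/] σ B b y)
rename-[/] σ (A ⊃ B) b y = cong₂ _⊃_ (rename-[/] σ A b y) (rename-[/] σ B b y)
rename-[/] σ (all z A) b y with z ≟ y
... | yes _ = refl
... | no _ = cong (all z) (rename-[/] σ A b y)
rename-[/] σ (ex z A) b y with z ≟ y
... | yes _ = refl
... | no _ = cong (ex z) (rename-[/] σ A b y)

renameᵗ-id : ∀ t → renameᵗ id t ≡ t
renameᵗ-id (var y) = refl
renameᵗ-id (par b) = refl

rename-id : ∀ A → rename id A ≡ A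
rename-id ⊥' = refl
rename-id (atom p ts) = cong (atom p) (trans (map-cong renameᵗ-id ts) (map-id ts))
rename-id (A ∧' B) = cong₂ _∧'_ (rename-id A) (rename-id B)
rename-id (A ∨' B) = cong₂ _∨'_ (rename-id A) (rename-id B)
rename-id (A ⊃ B) = cong₂ _⊃_ (rename-id A) (rename-id B)
rename-id (all y A) = cong (all y) (rename-id A)
rename-id (ex y A) = cong (ex y) (rename-id A)

renameᴸ-id : ∀ Γ → renameᴸ id Γ ≡ Γ
renameᴸ-id Γ = trans (map-cong rename-id Γ) (map-id Γ)

update : Renaming → Param → Param → Renaming
update σ c d p with p ≟ c
... | yes _ = d
... | no _ = σ p

update-same : ∀ σ c d → update σ c d c ≡ d
update-same σ c d with c ≟ c
... | yes _ = refl
... | no c≢c = contradiction refl c≢c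

update-other : ∀ σ {c} d {p} → p ≢ c → update σ c d p ≡ σ p
update-other σ {c} d {p} p≢c with p ≟ c
... | yes p≡c = contradiction p≡c p≢c
... | no _ = refl

Fresh : Param → Formula → Set
Fresh c A = c ∉ paramsF A

∉-++⁻ : ∀ {c : ℕ} xs {ys} → c ∉ xs ++ ys → c ∉ xs × c ∉ ys
∉-++⁻ xs c∉ = c∉ ∘ ∈-++⁺ˡ , c∉ ∘ ∈-++⁺ʳ xs

∉-concatMap⁻ : ∀ {A : Set} {c : ℕ} (f : A → List ℕ) xs →
               c ∉ concatMap f xs → All (λ x → c ∉ f x) xs
∉-concatMap⁻ f xs c∉ = ¬Any⇒All¬ xs (c∉ ∘ ∈-concatMap⁺ f)

renameᵗˢ-update-fresh : ∀ σ {c} d ts → c ∉ concatMap paramsT ts →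
                        map (renameᵗ (update σ c d)) ts ≡ map (renameᵗ σ) ts
renameᵗˢ-update-fresh σ d [] c∉ = refl
renameᵗˢ-update-fresh σ d (var y ∷ ts) c∉ = cong (var y ∷_) (renameᵗˢ-update-fresh σ d ts c∉)
renameᵗˢ-update-fresh σ d (par b ∷ ts) c∉ =
  cong₂ (λ p us → par p ∷ us) (update-other σ d (λ b≡c → c∉ (here (sym b≡c))))
        (renameᵗˢ-update-fresh σ d ts (c∉ ∘ there))

rename-update-fresh : ∀ σ {c} d A → Fresh c A → rename (update σ c d) A ≡ rename σ A
rename-update-fresh σ d ⊥' c∉ = refl
rename-update-fresh σ d (atom p ts) c∉ = cong (atom p) (renameᵗˢ-update-fresh σ d ts c∉)
rename-update-fresh σ d (A ∧' B) c∉ with ∉-++⁻ (paramsF A) c∉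
... | c∉A , c∉B = cong₂ _∧'_ (rename-update-fresh σ d A c∉A) (rename-update-fresh σ d B c∉B)
rename-update-fresh σ d (A ∨' B) c∉ with ∉-++⁻ (paramsF A) c∉
... | c∉A , c∉B = cong₂ _∨'_ (rename-update-fresh σ d A c∉A) (rename-update-fresh σ d B c∉B)
rename-update-fresh σ d (A ⊃ B) c∉ with ∉-++⁻ (paramsF A) c∉
... | c∉A , c∉B = cong₂ _⊃_ (rename-update-fresh σ d A c∉A) (rename-update-fresh σ d B c∉B)
rename-update-fresh σ d (all y A) c∉ = cong (all y) (rename-update-fresh σ d A c∉)
rename-update-fresh σ d (ex y A) c∉ = cong (ex y) (rename-update-fresh σ d A c∉)

renameᴸ-update-fresh : ∀ σ {c} d {Γ} → All (Fresh c) Γ → renameᴸ (update σ c d) Γ ≡ renameᴸ σ Γ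
renameᴸ-update-fresh σ d [] = refl
renameᴸ-update-fresh σ d (c∉A ∷ c∉Γ) =
  cong₂ _∷_ (rename-update-fresh σ d _ c∉A) (renameᴸ-update-fresh σ d c∉Γ)

rename-update-instance : ∀ σ {c} d B y → Fresh c B →
                         rename (update σ c d) (B [ c / y ]) ≡ rename σ B [ d / y ]
rename-update-instance σ {c} d B y c∉B = begin
  rename (update σ c d) (B [ c / y ])             ≡⟨ rename-[/] (update σ c d) B c y ⟩
  rename (update σ c d) B [ update σ c d c / y ]  ≡⟨ cong₂ (λ X e → X [ e / y ])
                                                       (rename-update-fresh σ d B c∉B) (update-same σ c d) ⟩
  rename σ B [ d / y ]                            ∎
  where open ≡-Reasoning

fresh : (ps : List Param) → ∃ λ d → d ∉ ps
fresh ps = suc (sum ps) , λ d∈ps → n≮n (sum ps) (∈⇒≤sum d∈ps)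
  where
  ∈⇒≤sum : ∀ {n qs} → n ∈ qs → n ≤ sum qs
  ∈⇒≤sum {qs = q ∷ qs} (here refl) = m≤m+n q (sum qs)
  ∈⇒≤sum {qs = q ∷ qs} (there n∈qs) = ≤-trans (∈⇒≤sum n∈qs) (m≤n+m (sum qs) q)

infix 4 _⊆ₘ_
_⊆ₘ_ : {A : Set} → List A → List A → Set
xs ⊆ₘ ys = ∃ λ zs → ys ↭ xs ++ zs

module _ {A : Set} where

  ⊆ₘ-refl : ∀ {xs : List A} → xs ⊆ₘ xs
  ⊆ₘ-refl {xs} = [] , ↭-reflexive (sym (++-identityʳ xs))

  []⊆ₘ : ∀ {ys : List A} → [] ⊆ₘ ys
  []⊆ₘ {ys} = ys , ↭-refl

  ∈⇒∷⊆ₘ : ∀ {x : A} {ys} → x ∈ ys → x ∷ [] ⊆ₘ ys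
  ∈⇒∷⊆ₘ {x} x∈ys with ∈-∃++ x∈ys
  ... | ws , zs , refl = ws ++ zs , shift x ws zs

  ++⁺ˡ-⊆ₘ : ∀ zs {xs ys : List A} → xs ⊆ₘ ys → zs ++ xs ⊆ₘ zs ++ ys
  ++⁺ˡ-⊆ₘ zs {xs} (ws , ys↭) = ws , ↭-trans (++⁺ˡ zs ys↭) (↭-reflexive (sym (++-assoc zs xs ws)))

  ↭-⊆ₘ : ∀ {xs xs′ ys : List A} → xs ↭ xs′ → xs′ ⊆ₘ ys → xs ⊆ₘ ys
  ↭-⊆ₘ xs↭ (ws , ys↭) = ws , ↭-trans ys↭ (++⁺ʳ ws (↭-sym xs↭))

  ∷-⊆ₘ⁻ : ∀ {x : A} {xs ys} → x ∷ xs ⊆ₘ ys → ∃ λ ys′ → ys ↭ x ∷ ys′ × xs ⊆ₘ ys′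
  ∷-⊆ₘ⁻ (ws , ys↭) = _ , ys↭ , ws , ↭-refl

  ∷-↭-∷⁻ : ∀ {x y : A} {xs ys} → x ∷ xs ↭ y ∷ ys →
           (x ≡ y × xs ↭ ys) ⊎ ∃ λ zs → xs ↭ y ∷ zs × ys ↭ x ∷ zs
  ∷-↭-∷⁻ {x} {y} x∷xs↭ with ∈-resp-↭ (↭-sym x∷xs↭) (here refl)
  ... | here refl = inj₁ (refl , drop-∷ x∷xs↭)
  ... | there y∈xs with ∈-∃++ y∈xs
  ...   | ws , zs , refl = inj₂ (ws ++ zs , shift y ws zs ,
          drop-∷ (↭-trans (↭-sym x∷xs↭) (↭-trans (prep x (shift y ws zs)) (swap x y ↭-refl))))

≈C-refl : ∀ {C} → C ≈C C
≈C-refl {Γ ⊢ Δ} = ↭-refl , ↭-refl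

≈S-refl : ∀ {S} → S ≈S S
≈S-refl = Pointwise.refl ≈C-refl

perm-at : ∀ S₁ S₂ {C C′} → C ≈C C′ → LNIF (S₁ ++ C ∷ S₂) → LNIF (S₁ ++ C′ ∷ S₂)
perm-at S₁ S₂ C≈ = perm (Pointwise.++⁺ ≈S-refl (C≈ ∷ ≈S-refl))

perm-at₂ : ∀ S₁ S₂ S₃ {C C′ D D′} → C ≈C C′ → D ≈C D′ →
           LNIF (S₁ ++ C ∷ S₂ ++ D ∷ S₃) → LNIF (S₁ ++ C′ ∷ S₂ ++ D′ ∷ S₃)
perm-at₂ S₁ S₂ S₃ C≈ D≈ = perm (Pointwise.++⁺ ≈S-refl (C≈ ∷ Pointwise.++⁺ ≈S-refl (D≈ ∷ ≈S-refl)))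

LNIF-reassoc : ∀ S₁ C S₂ → LNIF ((S₁ ++ C ∷ []) ++ S₂) → LNIF (S₁ ++ C ∷ S₂)
LNIF-reassoc S₁ C S₂ = subst LNIF (++-assoc S₁ (C ∷ []) S₂)

LNIF-unassoc : ∀ S₁ C S₂ → LNIF (S₁ ++ C ∷ S₂) → LNIF ((S₁ ++ C ∷ []) ++ S₂)
LNIF-unassoc S₁ C S₂ = subst LNIF (sym (++-assoc S₁ (C ∷ []) S₂))

-- The premises are demanded for every d so that ∀r₁ and ∀r₂ can choose their eigenvariable fresh.
module RightRule (F : Formula) (N : Param → Component)
  (rule₁ : ∀ G Γ Δ → (∀ d → LNIF (G ++ (Γ ⊢ Δ) ∷ N d ∷ [])) → LNIF (G ++ (Γ ⊢ F ∷ Δ) ∷ []))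
  (rule₂ : ∀ G H Γ₁ Δ₁ Γ₂ Δ₂ → (∀ d → LNIF (G ++ (Γ₁ ⊢ Δ₁) ∷ N d ∷ (Γ₂ ⊢ Δ₂) ∷ H)) →
           LNIF (G ++ (Γ₁ ⊢ Δ₁) ∷ (Γ₂ ⊢ F ∷ Δ₂) ∷ H) →
           LNIF (G ++ (Γ₁ ⊢ F ∷ Δ₁) ∷ (Γ₂ ⊢ Δ₂) ∷ H)) where

  rule*₁ : ∀ G Γ Δ R →
    (∀ R₁ R₂ d → R₁ ++ R₂ ≡ R → LNIF (G ++ (Γ ⊢ Δ) ∷ R₁ ++ N d ∷ R₂)) →
    LNIF (G ++ (Γ ⊢ F ∷ Δ) ∷ R)
  rule*₁ G Γ Δ [] prem = rule₁ G Γ Δ (λ d → prem [] [] d refl)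
  rule*₁ G Γ Δ ((Γ₂ ⊢ Δ₂) ∷ R) prem =
    rule₂ G R Γ Δ Γ₂ Δ₂ (λ d → prem [] _ d refl)
      (LNIF-reassoc G (Γ ⊢ Δ) _ (rule*₁ (G ++ (Γ ⊢ Δ) ∷ []) Γ₂ Δ₂ R
        (λ R₁ R₂ d eq → LNIF-unassoc G (Γ ⊢ Δ) _ (prem ((Γ₂ ⊢ Δ₂) ∷ R₁) R₂ d (cong (_ ∷_) eq)))))

  rule*₂ : ∀ G Γ Δ M Γ₂ Δ₂ H →
    (∀ M₁ M₂ d → M₁ ++ M₂ ≡ M → LNIF (G ++ (Γ ⊢ Δ) ∷ M₁ ++ N d ∷ M₂ ++ (Γ₂ ⊢ Δ₂) ∷ H)) →
    LNIF (G ++ (Γ ⊢ Δ) ∷ M ++ (Γ₂ ⊢ F ∷ Δ₂) ∷ H) →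
    LNIF (G ++ (Γ ⊢ F ∷ Δ) ∷ M ++ (Γ₂ ⊢ Δ₂) ∷ H)
  rule*₂ G Γ Δ [] Γ₂ Δ₂ H prem moved = rule₂ G H Γ Δ Γ₂ Δ₂ (λ d → prem [] [] d refl) moved
  rule*₂ G Γ Δ ((Γ₁ ⊢ Δ₁) ∷ M) Γ₂ Δ₂ H prem moved =
    rule₂ G _ Γ Δ Γ₁ Δ₁ (λ d → prem [] _ d refl)
      (LNIF-reassoc G (Γ ⊢ Δ) _ (rule*₂ (G ++ (Γ ⊢ Δ) ∷ []) Γ₁ Δ₁ M Γ₂ Δ₂ H
        (λ M₁ M₂ d eq → LNIF-unassoc G (Γ ⊢ Δ) _ (prem ((Γ₁ ⊢ Δ₁) ∷ M₁) M₂ d (cong (_ ∷_) eq)))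
        (LNIF-unassoc G (Γ ⊢ Δ) _ moved)))

implication-component : Formula → Formula → Param → Component
implication-component A B _ = A ∷ [] ⊢ B ∷ []

⊃r₁-any : ∀ A B G Γ Δ → (∀ d → LNIF (G ++ (Γ ⊢ Δ) ∷ implication-component A B d ∷ [])) →
          LNIF (G ++ (Γ ⊢ (A ⊃ B) ∷ Δ) ∷ [])
⊃r₁-any A B G Γ Δ prem = ⊃r₁ G Γ Δ A B (prem 0)

⊃r₂-any : ∀ A B G H Γ₁ Δ₁ Γ₂ Δ₂ →
          (∀ d → LNIF (G ++ (Γ₁ ⊢ Δ₁) ∷ implication-component A B d ∷ (Γ₂ ⊢ Δ₂) ∷ H)) →
          LNIF (G ++ (Γ₁ ⊢ Δ₁) ∷ (Γ₂ ⊢ (A ⊃ B) ∷ Δ₂) ∷ H) →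
          LNIF (G ++ (Γ₁ ⊢ (A ⊃ B) ∷ Δ₁) ∷ (Γ₂ ⊢ Δ₂) ∷ H)
⊃r₂-any A B G H Γ₁ Δ₁ Γ₂ Δ₂ prem = ⊃r₂ G H Γ₁ Δ₁ Γ₂ Δ₂ A B (prem 0)

instance-component : BVar → Formula → Param → Component
instance-component y B d = [] ⊢ B [ d / y ] ∷ []

∀r₁-fresh : ∀ y B G Γ Δ → (∀ d → LNIF (G ++ (Γ ⊢ Δ) ∷ instance-component y B d ∷ [])) →
            LNIF (G ++ (Γ ⊢ all y B ∷ Δ) ∷ [])
∀r₁-fresh y B G Γ Δ prem with fresh (paramsS (G ++ (Γ ⊢ all y B ∷ Δ) ∷ []))
... | d , d∉ = ∀r₁ G Γ Δ y B d d∉ (prem d)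

∀r₂-fresh : ∀ y B G H Γ₁ Δ₁ Γ₂ Δ₂ →
            (∀ d → LNIF (G ++ (Γ₁ ⊢ Δ₁) ∷ instance-component y B d ∷ (Γ₂ ⊢ Δ₂) ∷ H)) →
            LNIF (G ++ (Γ₁ ⊢ Δ₁) ∷ (Γ₂ ⊢ all y B ∷ Δ₂) ∷ H) →
            LNIF (G ++ (Γ₁ ⊢ all y B ∷ Δ₁) ∷ (Γ₂ ⊢ Δ₂) ∷ H)
∀r₂-fresh y B G H Γ₁ Δ₁ Γ₂ Δ₂ prem
  with fresh (paramsS (G ++ (Γ₁ ⊢ all y B ∷ Δ₁) ∷ (Γ₂ ⊢ Δ₂) ∷ H))
... | d , d∉ = ∀r₂ G H Γ₁ Δ₁ Γ₂ Δ₂ y B d d∉ (prem d)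

module ⊃r* (A B : Formula) =
  RightRule (A ⊃ B) (implication-component A B) (⊃r₁-any A B) (⊃r₂-any A B)
module ∀r* (y : BVar) (B : Formula) =
  RightRule (all y B) (instance-component y B) (∀r₁-fresh y B) (∀r₂-fresh y B)

addˡ : Formula → Component → Component
addˡ A (Γ ⊢ Δ) = A ∷ Γ ⊢ Δ

lift* : ∀ G A Γ₁ Δ₁ M Γ₂ Δ₂ H →
        LNIF (G ++ (A ∷ Γ₁ ⊢ Δ₁) ∷ map (addˡ A) M ++ (A ∷ Γ₂ ⊢ Δ₂) ∷ H) →
        LNIF (G ++ (A ∷ Γ₁ ⊢ Δ₁) ∷ M ++ (Γ₂ ⊢ Δ₂) ∷ H)
lift* G A Γ₁ Δ₁ [] Γ₂ Δ₂ H d = lift G H Γ₁ Δ₁ Γ₂ Δ₂ A d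
lift* G A Γ₁ Δ₁ ((Γ ⊢ Δ) ∷ M) Γ₂ Δ₂ H d =
  lift G _ Γ₁ Δ₁ Γ Δ A
    (LNIF-reassoc G _ _ (lift* (G ++ (A ∷ Γ₁ ⊢ Δ₁) ∷ []) A Γ Δ M Γ₂ Δ₂ H (LNIF-unassoc G _ _ d)))

variable
  σ : Renaming
  S T : LNS
  C C′ D : Component
  Γ Δ Γ′ Δ′ : List Formula
  F : Formula

infix 4 _≼⟨_⟩_
_≼⟨_⟩_ : Component → Renaming → Component → Set
(Γ ⊢ Δ) ≼⟨ σ ⟩ (Γ′ ⊢ Δ′) = renameᴸ σ Γ ⊆ₘ Γ′ × renameᴸ σ Δ ⊆ₘ Δ′

renameᴸ-++⁺-⊆ₘ : ∀ σ Φ {Γ Γ′} → renameᴸ σ Γ ⊆ₘ Γ′ → renameᴸ σ (Φ ++ Γ) ⊆ₘ renameᴸ σ Φ ++ Γ′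
renameᴸ-++⁺-⊆ₘ σ Φ {Γ} Γ⊆ = subst (_⊆ₘ _) (sym (map-++ (rename σ) Φ Γ)) (++⁺ˡ-⊆ₘ (renameᴸ σ Φ) Γ⊆)

renameᴸ-↭-⊆ₘ : ∀ σ {Γ Γ₀ Γ′} → Γ ↭ Γ₀ → renameᴸ σ Γ₀ ⊆ₘ Γ′ → renameᴸ σ Γ ⊆ₘ Γ′
renameᴸ-↭-⊆ₘ σ Γ↭ = ↭-⊆ₘ (map⁺ (rename σ) Γ↭)

renameᴸ-update-⊆ₘ : ∀ σ {c} d {Γ Γ′} → All (Fresh c) Γ →
                    renameᴸ σ Γ ⊆ₘ Γ′ → renameᴸ (update σ c d) Γ ⊆ₘ Γ′
renameᴸ-update-⊆ₘ σ d c∉Γ = subst (_⊆ₘ _) (sym (renameᴸ-update-fresh σ d c∉Γ))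

≼-id : ∀ C → C ≼⟨ id ⟩ C
≼-id (Γ ⊢ Δ) = subst (_⊆ₘ Γ) (sym (renameᴸ-id Γ)) ⊆ₘ-refl ,
               subst (_⊆ₘ Δ) (sym (renameᴸ-id Δ)) ⊆ₘ-refl

≼-rename : ∀ σ Γ Δ → (Γ ⊢ Δ) ≼⟨ σ ⟩ (renameᴸ σ Γ ⊢ renameᴸ σ Δ)
≼-rename σ Γ Δ = ⊆ₘ-refl , ⊆ₘ-refl

≼-∷ˡ⁻ : (F ∷ Γ ⊢ Δ) ≼⟨ σ ⟩ (Γ′ ⊢ Δ′) →
        ∃ λ Γ″ → Γ′ ↭ rename σ F ∷ Γ″ × (Γ ⊢ Δ) ≼⟨ σ ⟩ (Γ″ ⊢ Δ′)
≼-∷ˡ⁻ (Γ⊆ , Δ⊆) with ∷-⊆ₘ⁻ Γ⊆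
... | Γ″ , Γ′↭ , Γ⊆′ = Γ″ , Γ′↭ , Γ⊆′ , Δ⊆

≼-resp : ∀ {Γ₀ Δ₀} → Γ ↭ Γ₀ → Δ ↭ Δ₀ → (Γ₀ ⊢ Δ₀) ≼⟨ σ ⟩ D → (Γ ⊢ Δ) ≼⟨ σ ⟩ D
≼-resp {σ = σ} {D = Γ′ ⊢ Δ′} Γ↭ Δ↭ (Γ⊆ , Δ⊆) = renameᴸ-↭-⊆ₘ σ Γ↭ Γ⊆ , renameᴸ-↭-⊆ₘ σ Δ↭ Δ⊆

≼-update : ∀ {c} d → All (Fresh c) Γ → All (Fresh c) Δ →
           (Γ ⊢ Δ) ≼⟨ σ ⟩ C → (Γ ⊢ Δ) ≼⟨ update σ c d ⟩ C
≼-update {σ = σ} {C = Γ′ ⊢ Δ′} d c∉Γ c∉Δ (Γ⊆ , Δ⊆) =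
  renameᴸ-update-⊆ₘ σ d c∉Γ Γ⊆ , renameᴸ-update-⊆ₘ σ d c∉Δ Δ⊆

FreshC : Param → Component → Set
FreshC c (Γ ⊢ Δ) = All (Fresh c) Γ × All (Fresh c) Δ

∉paramsS⇒FreshC : ∀ {c} S → c ∉ paramsS S → All (FreshC c) S
∉paramsS⇒FreshC S c∉ = All.map ∉paramsC⇒FreshC (∉-concatMap⁻ paramsC S c∉)
  where
  ∉paramsC⇒FreshC : ∀ {c C} → c ∉ paramsC C → FreshC c C
  ∉paramsC⇒FreshC {C = Γ ⊢ Δ} c∉ with ∉-++⁻ (concatMap paramsF Γ) c∉
  ... | c∉Γ , c∉Δ = ∉-concatMap⁻ paramsF Γ c∉Γ , ∉-concatMap⁻ paramsF Δ c∉Δ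

∉paramsS⇒FreshC-at : ∀ {c} G C H → c ∉ paramsS (G ++ C ∷ H) →
                     All (FreshC c) G × FreshC c C × All (FreshC c) H
∉paramsS⇒FreshC-at G C H c∉ with ++⁻ G (∉paramsS⇒FreshC (G ++ C ∷ H) c∉)
... | fG , fC ∷ fH = fG , fC , fH

instance-≼ : ∀ σ {c} d y B {Γ′ Δ′} → Fresh c B → rename σ B [ d / y ] ∷ [] ⊆ₘ Δ′ →
             instance-component y B c ≼⟨ update σ c d ⟩ (Γ′ ⊢ Δ′)
instance-≼ σ d y B c∉B ⊆Δ′ =
  []⊆ₘ , subst (λ X → X ∷ [] ⊆ₘ _) (sym (rename-update-instance σ d B y c∉B)) ⊆Δ′

data Phase : Set where
  before pending after : Phase

rank : Phase → ℕ
rank before = 0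
rank pending = 1
rank after = 2

-- The phase of an embedding is before the omitted formula, pending while its witness is owed,
-- and after the witness.
module Inversion (I : Formula) where

  variable
    s t u : Phase

  data Step (σ : Renaming) : Phase → Phase → Component → Component → Set where
    keep : ∀ {s C D} → C ≼⟨ σ ⟩ D → Step σ s s C D
    drop : ∀ {Γ Δ Δ₀ D} y B b → Δ ↭ all y B ∷ Δ₀ → (Γ ⊢ Δ₀) ≼⟨ σ ⟩ D → rename σ B [ b / y ] ≡ I →
           Step σ before pending (Γ ⊢ Δ) D

  infixr 5 _∷_ _++ᴱ_
  data Embedding (σ : Renaming) : Phase → Phase → LNS → LNS → Set where
    []      : ∀ {s} → Embedding σ s s [] []
    insert  : ∀ {s t S T} D → Embedding σ s t S T → Embedding σ s t S (D ∷ T)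
    _∷_     : ∀ {s t u C D S T} → Step σ s t C D → Embedding σ t u S T →
              Embedding σ s u (C ∷ S) (D ∷ T)
    witness : ∀ {t S T Γ Δ} → I ∈ Δ → Embedding σ after t S T →
              Embedding σ pending t S ((Γ ⊢ Δ) ∷ T)

  _++ᴱ_ : ∀ {S₁ S₂ T₁ T₂} → Embedding σ s t S₁ T₁ → Embedding σ t u S₂ T₂ →
          Embedding σ s u (S₁ ++ S₂) (T₁ ++ T₂)
  [] ++ᴱ e′ = e′
  insert D e ++ᴱ e′ = insert D (e ++ᴱ e′)
  (x ∷ e) ++ᴱ e′ = x ∷ (e ++ᴱ e′)
  witness w e ++ᴱ e′ = witness w (e ++ᴱ e′)

  phase-mono : Embedding σ s t S T → rank s ≤ rank t
  phase-mono [] = ≤-refl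
  phase-mono (insert D e) = phase-mono e
  phase-mono (keep _ ∷ e) = phase-mono e
  phase-mono (drop _ _ _ _ _ _ ∷ e) = z≤n
  phase-mono (witness _ e) = ≤-trans (n≤1+n 1) (phase-mono e)

  after-final : Embedding σ after t S T → t ≡ after
  after-final {t = before} e = contradiction (phase-mono e) λ ()
  after-final {t = pending} e = contradiction (phase-mono e) λ { (s≤s ()) }
  after-final {t = after} e = refl

  rephase : Embedding σ s s S T → Embedding σ t t S T
  rephase [] = []
  rephase (insert D e) = insert D (rephase e)
  rephase (keep c ∷ e) = keep c ∷ rephase e
  rephase (drop _ _ _ _ _ _ ∷ e) = contradiction (phase-mono e) λ ()
  rephase (witness _ e) = contradiction (phase-mono e) λ { (s≤s ()) }

  rename-[] : ∀ {σ′} → Embedding σ s t [] T → Embedding σ′ s t [] T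
  rename-[] [] = []
  rename-[] (insert D e) = insert D (rename-[] e)
  rename-[] (witness w e) = witness w (rename-[] e)

  Step-∷ˡ⁻ : Step σ s t (F ∷ Γ ⊢ Δ) (Γ′ ⊢ Δ′) →
             ∃ λ Γ″ → Γ′ ↭ rename σ F ∷ Γ″ × Step σ s t (Γ ⊢ Δ) (Γ″ ⊢ Δ′)
  Step-∷ˡ⁻ (keep c) with ≼-∷ˡ⁻ c
  ... | Γ″ , Γ′↭ , c′ = Γ″ , Γ′↭ , keep c′
  Step-∷ˡ⁻ (drop y B b Δ↭ c eq) with ≼-∷ˡ⁻ c
  ... | Γ″ , Γ′↭ , c′ = Γ″ , Γ′↭ , drop y B b Δ↭ c′ eq

  data View∷ʳ (σ : Renaming) (Γ : List Formula) :
              Phase → Phase → Formula → List Formula → Component → Set where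
    dropped : ∀ {Δ D} y B b → (Γ ⊢ Δ) ≼⟨ σ ⟩ D → rename σ B [ b / y ] ≡ I →
              View∷ʳ σ Γ before pending (all y B) Δ D
    kept    : ∀ {s t F Δ Γ′ Δ′} Δ″ → Δ′ ↭ rename σ F ∷ Δ″ → Step σ s t (Γ ⊢ Δ) (Γ′ ⊢ Δ″) →
              View∷ʳ σ Γ s t F Δ (Γ′ ⊢ Δ′)

  view∷ʳ : Step σ s t (Γ ⊢ F ∷ Δ) D → View∷ʳ σ Γ s t F Δ D
  view∷ʳ {D = Γ′ ⊢ Δ′} (keep (Γ⊆ , Θ , Δ′↭)) = kept _ Δ′↭ (keep (Γ⊆ , Θ , ↭-refl))
  view∷ʳ {σ = σ} {D = Γ′ ⊢ Δ′} (drop y B b F∷Δ↭ (Γ⊆ , Θ , Δ′↭) eq) with ∷-↭-∷⁻ F∷Δ↭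
  ... | inj₁ (refl , Δ↭) = dropped y B b (Γ⊆ , renameᴸ-↭-⊆ₘ σ Δ↭ (Θ , Δ′↭)) eq
  ... | inj₂ (Ζ , Δ↭ , Δ₀↭) =
    kept (renameᴸ σ Ζ ++ Θ) (↭-trans Δ′↭ (++⁺ʳ Θ (map⁺ (rename σ) Δ₀↭)))
         (drop y B b Δ↭ (Γ⊆ , Θ , ↭-refl) eq)

  Step-addˡ : ∀ Φ → Step σ s t (Γ ⊢ Δ) (Γ′ ⊢ Δ′) → Step σ s t (Φ ++ Γ ⊢ Δ) (renameᴸ σ Φ ++ Γ′ ⊢ Δ′)
  Step-addˡ {σ = σ} Φ (keep (Γ⊆ , Δ⊆)) = keep (renameᴸ-++⁺-⊆ₘ σ Φ Γ⊆ , Δ⊆)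
  Step-addˡ {σ = σ} Φ (drop y B b Δ↭ (Γ⊆ , Δ⊆) eq) = drop y B b Δ↭ (renameᴸ-++⁺-⊆ₘ σ Φ Γ⊆ , Δ⊆) eq

  Step-addʳ : ∀ Φ → Step σ s t (Γ ⊢ Δ) (Γ′ ⊢ Δ′) → Step σ s t (Γ ⊢ Φ ++ Δ) (Γ′ ⊢ renameᴸ σ Φ ++ Δ′)
  Step-addʳ {σ = σ} Φ (keep (Γ⊆ , Δ⊆)) = keep (Γ⊆ , renameᴸ-++⁺-⊆ₘ σ Φ Δ⊆)
  Step-addʳ {σ = σ} Φ (drop {Δ₀ = Δ₀} y B b Δ↭ (Γ⊆ , Δ⊆) eq) =
    drop y B b (↭-trans (++⁺ˡ Φ Δ↭) (shift (all y B) Φ Δ₀)) (Γ⊆ , renameᴸ-++⁺-⊆ₘ σ Φ Δ⊆) eq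

  Step-resp : C ≈C C′ → Step σ s t C′ D → Step σ s t C D
  Step-resp {C = Γ ⊢ Δ} {Γ₀ ⊢ Δ₀} (Γ↭ , Δ↭) (keep c) = keep (≼-resp Γ↭ Δ↭ c)
  Step-resp {C = Γ ⊢ Δ} {Γ₀ ⊢ Δ₀} (Γ↭ , Δ↭) (drop y B b Δ₀↭ c eq) =
    drop y B b (↭-trans Δ↭ Δ₀↭) (≼-resp Γ↭ ↭-refl c) eq

  Embedding-resp : ∀ {S′} → S ≈S S′ → Embedding σ s t S′ T → Embedding σ s t S T
  Embedding-resp [] [] = []
  Embedding-resp S≈ (insert D e) = insert D (Embedding-resp S≈ e)
  Embedding-resp (C≈ ∷ S≈) (x ∷ e) = Step-resp C≈ x ∷ Embedding-resp S≈ e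
  Embedding-resp S≈ (witness w e) = witness w (Embedding-resp S≈ e)

  Step-update : ∀ {c} d → FreshC c C → Step σ s t C D → Step (update σ c d) s t C D
  Step-update {C = Γ ⊢ Δ} d (c∉Γ , c∉Δ) (keep c) = keep (≼-update d c∉Γ c∉Δ c)
  Step-update {C = Γ ⊢ Δ} {σ = σ} d (c∉Γ , c∉Δ) (drop y B b Δ↭ c eq) with All-resp-↭ Δ↭ c∉Δ
  ... | c∉B ∷ c∉Δ₀ =
    drop y B b Δ↭ (≼-update d c∉Γ c∉Δ₀ c) (trans (cong (_[ b / y ]) (rename-update-fresh σ d B c∉B)) eq)

  Embedding-update : ∀ {c} d → All (FreshC c) S → Embedding σ s t S T → Embedding (update σ c d) s t S T
  Embedding-update d f [] = []
  Embedding-update d f (insert D e) = insert D (Embedding-update d f e)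
  Embedding-update d (fC ∷ f) (x ∷ e) = Step-update d fC x ∷ Embedding-update d f e
  Embedding-update d f (witness w e) = witness w (Embedding-update d f e)

  Embedding-addˡ : ∀ A → Embedding σ s t [] T → Embedding σ s t [] (map (addˡ A) T)
  Embedding-addˡ A [] = []
  Embedding-addˡ A (insert D e) = insert (addˡ A D) (Embedding-addˡ A e)
  Embedding-addˡ A (witness w e) = witness w (Embedding-addˡ A e)

  data Focus (σ : Renaming) (s t : Phase) (G : LNS) (C : Component) (H : LNS) : LNS → Set where
    focus : ∀ {u u′} T₁ D T₂ → Embedding σ s u G T₁ → Step σ u u′ C D → Embedding σ u′ t H T₂ →
            Focus σ s t G C H (T₁ ++ D ∷ T₂)

  focus-on : ∀ G {H} → Embedding σ s t (G ++ C ∷ H) T → Focus σ s t G C H T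
  focus-on [] (insert D e) with focus-on [] e
  ... | focus T₁ D′ T₂ e₁ x e₂ = focus (D ∷ T₁) D′ T₂ (insert D e₁) x e₂
  focus-on [] (x ∷ e) = focus [] _ _ [] x e
  focus-on [] (witness w e) with focus-on [] e
  ... | focus T₁ D′ T₂ e₁ x e₂ = focus (_ ∷ T₁) D′ T₂ (witness w e₁) x e₂
  focus-on (C₀ ∷ G) (insert D e) with focus-on (C₀ ∷ G) e
  ... | focus T₁ D′ T₂ e₁ x e₂ = focus (D ∷ T₁) D′ T₂ (insert D e₁) x e₂
  focus-on (C₀ ∷ G) (x₀ ∷ e) with focus-on G e
  ... | focus T₁ D′ T₂ e₁ x e₂ = focus (_ ∷ T₁) D′ T₂ (x₀ ∷ e₁) x e₂
  focus-on (C₀ ∷ G) (witness w e) with focus-on (C₀ ∷ G) e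
  ... | focus T₁ D′ T₂ e₁ x e₂ = focus (_ ∷ T₁) D′ T₂ (witness w e₁) x e₂

  split-[] : ∀ T₁ T₂ → T₁ ++ T₂ ≡ T → Embedding σ s t [] T →
             ∃ λ u → Embedding σ s u [] T₁ × Embedding σ u t [] T₂
  split-[] [] T₂ refl e = _ , [] , e
  split-[] (D ∷ T₁) T₂ refl (insert D e) with split-[] T₁ T₂ refl e
  ... | u , e₁ , e₂ = u , insert D e₁ , e₂
  split-[] (D ∷ T₁) T₂ refl (witness w e) with split-[] T₁ T₂ refl e
  ... | u , e₁ , e₂ = u , witness w e₁ , e₂

  data Witnessed (σ : Renaming) (t : Phase) (S : LNS) : LNS → Set where
    witnessed : ∀ T₁ Γ Δ T₂ → Embedding σ pending pending [] T₁ → I ∈ Δ → Embedding σ after t S T₂ →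
                Witnessed σ t S (T₁ ++ (Γ ⊢ Δ) ∷ T₂)

  find-witness : Embedding σ pending t [] T → t ≢ pending → Witnessed σ t [] T
  find-witness [] t≢ = contradiction refl t≢
  find-witness (insert D e) t≢ with find-witness e t≢
  ... | witnessed T₁ Γ Δ T₂ e₁ w e₂ = witnessed (D ∷ T₁) Γ Δ T₂ (insert D e₁) w e₂
  find-witness (witness w e) t≢ = witnessed [] _ _ _ [] w e

  data WitnessOrImage (σ : Renaming) (t : Phase) (C : Component) (H : LNS) : LNS → Set where
    witness-first : Witnessed σ t (C ∷ H) T → WitnessOrImage σ t C H T
    image-first   : ∀ {u} T₁ D T₂ → Embedding σ pending pending [] T₁ → Step σ pending u C D →
                    Embedding σ u t H T₂ → WitnessOrImage σ t C H (T₁ ++ D ∷ T₂)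

  witness-or-image : ∀ {H} → Embedding σ pending t (C ∷ H) T → WitnessOrImage σ t C H T
  witness-or-image (insert D e) with witness-or-image e
  ... | witness-first (witnessed T₁ Γ Δ T₂ e₁ w e₂) =
    witness-first (witnessed (D ∷ T₁) Γ Δ T₂ (insert D e₁) w e₂)
  ... | image-first T₁ D′ T₂ e₁ x e₂ = image-first (D ∷ T₁) D′ T₂ (insert D e₁) x e₂
  witness-or-image (x ∷ e) = image-first [] _ _ [] x e
  witness-or-image (witness w e) = witness-first (witnessed [] _ _ _ [] w e)

  witness-≼ : ∀ σ {c} b y B {Γ′ Δ′} → Fresh c B → rename σ B [ b / y ] ≡ I → I ∈ Δ′ →
              instance-component y B c ≼⟨ update σ c b ⟩ (Γ′ ⊢ Δ′)
  witness-≼ σ b y B c∉B B[b/y]≡I w = instance-≼ σ b y B c∉B (∈⇒∷⊆ₘ (subst (_∈ _) (sym B[b/y]≡I) w))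

  place : ∀ {σ′} T₁ T₂ → T₁ ++ T₂ ≡ T → C ≼⟨ σ′ ⟩ D → Embedding σ s t [] T →
          Embedding σ′ s t (C ∷ []) (T₁ ++ D ∷ T₂)
  place T₁ T₂ eq c e with split-[] T₁ T₂ eq e
  ... | _ , e₁ , e₂ = rename-[] e₁ ++ᴱ keep c ∷ rename-[] e₂

  place-before : ∀ {σ′ S T′} T₁ T₂ → T₁ ++ T₂ ≡ T → C ≼⟨ σ′ ⟩ D → Embedding σ s t [] T →
                 Embedding σ′ t u S T′ → Embedding σ′ s u (C ∷ S) (T₁ ++ D ∷ T₂ ++ T′)
  place-before T₁ T₂ eq c e e′ with split-[] T₁ T₂ eq e
  ... | _ , e₁ , e₂ = rename-[] e₁ ++ᴱ keep c ∷ rename-[] e₂ ++ᴱ e′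

  ImagesDerivable : LNS → Set
  ImagesDerivable S = ∀ σ {t T} → Embedding σ before t S T → t ≢ pending → LNIF T

  perm-images : ∀ {S S′} → S ≈S S′ → ImagesDerivable S → ImagesDerivable S′
  perm-images S≈ ih σ e t≢ = ih σ (Embedding-resp S≈ e) t≢

  id₁-images : ∀ G H Γ Δ P ts → ImagesDerivable (G ++ (atom P ts ∷ Γ ⊢ atom P ts ∷ Δ) ∷ H)
  id₁-images G H Γ Δ P ts σ e _ with focus-on G e
  ... | focus T₁ (Γ′ ⊢ Δ′) T₂ _ x _ with Step-∷ˡ⁻ x
  ... | Γ″ , Γ′↭ , x′ with view∷ʳ x′
  ... | kept Δ″ Δ′↭ _ = perm-at T₁ T₂ (↭-sym Γ′↭ , ↭-sym Δ′↭) (id₁ T₁ T₂ Γ″ Δ″ P (map (renameᵗ σ) ts))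

  id₂-images : ∀ G H F Γ₁ Δ₁ Γ₂ Δ₂ P ts →
               ImagesDerivable (G ++ (atom P ts ∷ Γ₁ ⊢ Δ₁) ∷ H ++ (Γ₂ ⊢ atom P ts ∷ Δ₂) ∷ F)
  id₂-images G H F Γ₁ Δ₁ Γ₂ Δ₂ P ts σ e _ with focus-on G e
  ... | focus T₁ (Γ₁′ ⊢ Δ₁′) T₂ _ x₁ e₂ with focus-on H e₂ | Step-∷ˡ⁻ x₁
  ... | focus T₂′ (Γ₂′ ⊢ Δ₂′) T₃ _ x₂ _ | Γ₁″ , Γ₁′↭ , _ with view∷ʳ x₂
  ... | kept Δ₂″ Δ₂′↭ _ = perm-at₂ T₁ T₂′ T₃ (↭-sym Γ₁′↭ , ↭-refl) (↭-refl , ↭-sym Δ₂′↭)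
        (id₂ T₁ T₂′ T₃ Γ₁″ Δ₁′ Γ₂′ Δ₂″ P (map (renameᵗ σ) ts))

  ⊥l-images : ∀ G H Γ Δ → ImagesDerivable (G ++ (⊥' ∷ Γ ⊢ Δ) ∷ H)
  ⊥l-images G H Γ Δ σ e _ with focus-on G e
  ... | focus T₁ (Γ′ ⊢ Δ′) T₂ _ x _ with Step-∷ˡ⁻ x
  ... | Γ″ , Γ′↭ , _ = perm-at T₁ T₂ (↭-sym Γ′↭ , ↭-refl) (⊥l T₁ T₂ Γ″ Δ′)

  ∧l-images : ∀ G H Γ Δ A B → ImagesDerivable (G ++ (A ∷ B ∷ Γ ⊢ Δ) ∷ H) →
              ImagesDerivable (G ++ ((A ∧' B) ∷ Γ ⊢ Δ) ∷ H)
  ∧l-images G H Γ Δ A B ih σ e t≢ with focus-on G e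
  ... | focus T₁ (Γ′ ⊢ Δ′) T₂ e₁ x e₂ with Step-∷ˡ⁻ x
  ... | Γ″ , Γ′↭ , x′ = perm-at T₁ T₂ (↭-sym Γ′↭ , ↭-refl)
        (∧l T₁ T₂ Γ″ Δ′ (rename σ A) (rename σ B) (ih σ (e₁ ++ᴱ Step-addˡ (A ∷ B ∷ []) x′ ∷ e₂) t≢))

  ∨l-images : ∀ G H Γ Δ A B →
              ImagesDerivable (G ++ (A ∷ Γ ⊢ Δ) ∷ H) → ImagesDerivable (G ++ (B ∷ Γ ⊢ Δ) ∷ H) →
              ImagesDerivable (G ++ ((A ∨' B) ∷ Γ ⊢ Δ) ∷ H)
  ∨l-images G H Γ Δ A B ih₁ ih₂ σ e t≢ with focus-on G e
  ... | focus T₁ (Γ′ ⊢ Δ′) T₂ e₁ x e₂ with Step-∷ˡ⁻ x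
  ... | Γ″ , Γ′↭ , x′ = perm-at T₁ T₂ (↭-sym Γ′↭ , ↭-refl)
        (∨l T₁ T₂ Γ″ Δ′ (rename σ A) (rename σ B) (ih₁ σ (e₁ ++ᴱ Step-addˡ (A ∷ []) x′ ∷ e₂) t≢)
           (ih₂ σ (e₁ ++ᴱ Step-addˡ (B ∷ []) x′ ∷ e₂) t≢))

  ⊃l-images : ∀ G H Γ Δ A B → ImagesDerivable (G ++ (B ∷ Γ ⊢ Δ) ∷ H) →
              ImagesDerivable (G ++ ((A ⊃ B) ∷ Γ ⊢ A ∷ Δ) ∷ H) →
              ImagesDerivable (G ++ ((A ⊃ B) ∷ Γ ⊢ Δ) ∷ H)
  ⊃l-images G H Γ Δ A B ih₁ ih₂ σ e t≢ with focus-on G e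
  ... | focus T₁ (Γ′ ⊢ Δ′) T₂ e₁ x e₂ with Step-∷ˡ⁻ x
  ... | Γ″ , Γ′↭ , x′ = perm-at T₁ T₂ (↭-sym Γ′↭ , ↭-refl)
        (⊃l T₁ T₂ Γ″ Δ′ (rename σ A) (rename σ B) (ih₁ σ (e₁ ++ᴱ Step-addˡ (B ∷ []) x′ ∷ e₂) t≢)
           (ih₂ σ (e₁ ++ᴱ Step-addʳ (A ∷ []) (Step-addˡ ((A ⊃ B) ∷ []) x′) ∷ e₂) t≢))

  ∀l-images : ∀ G H Γ Δ y B b → ImagesDerivable (G ++ (B [ b / y ] ∷ all y B ∷ Γ ⊢ Δ) ∷ H) →
              ImagesDerivable (G ++ (all y B ∷ Γ ⊢ Δ) ∷ H)
  ∀l-images G H Γ Δ y B b ih σ e t≢ with focus-on G e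
  ... | focus T₁ (Γ′ ⊢ Δ′) T₂ e₁ x e₂ with Step-∷ˡ⁻ x
  ... | Γ″ , Γ′↭ , x′ = perm-at T₁ T₂ (↭-sym Γ′↭ , ↭-refl)
        (∀l T₁ T₂ Γ″ Δ′ y (rename σ B) (σ b)
          (subst (λ X → LNIF (T₁ ++ (X ∷ all y (rename σ B) ∷ Γ″ ⊢ Δ′) ∷ T₂)) (rename-[/] σ B b y)
            (ih σ (e₁ ++ᴱ Step-addˡ (B [ b / y ] ∷ all y B ∷ []) x′ ∷ e₂) t≢)))

  ∃l-images : ∀ G H Γ Δ y B c → c ∉ paramsS (G ++ (ex y B ∷ Γ ⊢ Δ) ∷ H) →
              ImagesDerivable (G ++ (B [ c / y ] ∷ Γ ⊢ Δ) ∷ H) →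
              ImagesDerivable (G ++ (ex y B ∷ Γ ⊢ Δ) ∷ H)
  ∃l-images G H Γ Δ y B c c∉ ih σ e t≢ with focus-on G e | ∉paramsS⇒FreshC-at G _ H c∉
  ... | focus T₁ (Γ′ ⊢ Δ′) T₂ e₁ x e₂ | fG , (c∉B ∷ c∉Γ , c∉Δ) , fH with Step-∷ˡ⁻ x
  ... | Γ″ , Γ′↭ , x′ with fresh (paramsS (T₁ ++ (ex y (rename σ B) ∷ Γ″ ⊢ Δ′) ∷ T₂))
  ... | d , d∉ = perm-at T₁ T₂ (↭-sym Γ′↭ , ↭-refl)
        (∃l T₁ T₂ Γ″ Δ′ y (rename σ B) d d∉
          (subst (λ X → LNIF (T₁ ++ (X ∷ Γ″ ⊢ Δ′) ∷ T₂)) (rename-update-instance σ d B y c∉B)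
            (ih (update σ c d) (Embedding-update d fG e₁ ++ᴱ
                                Step-addˡ (B [ c / y ] ∷ []) (Step-update d (c∉Γ , c∉Δ) x′) ∷
                                Embedding-update d fH e₂) t≢)))

  ∨r-images : ∀ G H Γ Δ A B → ImagesDerivable (G ++ (Γ ⊢ A ∷ B ∷ Δ) ∷ H) →
              ImagesDerivable (G ++ (Γ ⊢ (A ∨' B) ∷ Δ) ∷ H)
  ∨r-images G H Γ Δ A B ih σ e t≢ with focus-on G e
  ... | focus T₁ (Γ′ ⊢ Δ′) T₂ e₁ x e₂ with view∷ʳ x
  ... | kept Δ″ Δ′↭ x′ = perm-at T₁ T₂ (↭-refl , ↭-sym Δ′↭)
        (∨r T₁ T₂ Γ′ Δ″ (rename σ A) (rename σ B) (ih σ (e₁ ++ᴱ Step-addʳ (A ∷ B ∷ []) x′ ∷ e₂) t≢))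

  ∧r-images : ∀ G H Γ Δ A B →
              ImagesDerivable (G ++ (Γ ⊢ A ∷ Δ) ∷ H) → ImagesDerivable (G ++ (Γ ⊢ B ∷ Δ) ∷ H) →
              ImagesDerivable (G ++ (Γ ⊢ (A ∧' B) ∷ Δ) ∷ H)
  ∧r-images G H Γ Δ A B ih₁ ih₂ σ e t≢ with focus-on G e
  ... | focus T₁ (Γ′ ⊢ Δ′) T₂ e₁ x e₂ with view∷ʳ x
  ... | kept Δ″ Δ′↭ x′ = perm-at T₁ T₂ (↭-refl , ↭-sym Δ′↭)
        (∧r T₁ T₂ Γ′ Δ″ (rename σ A) (rename σ B) (ih₁ σ (e₁ ++ᴱ Step-addʳ (A ∷ []) x′ ∷ e₂) t≢)
           (ih₂ σ (e₁ ++ᴱ Step-addʳ (B ∷ []) x′ ∷ e₂) t≢))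

  ∃r-images : ∀ G H Γ Δ y B b → ImagesDerivable (G ++ (Γ ⊢ B [ b / y ] ∷ ex y B ∷ Δ) ∷ H) →
              ImagesDerivable (G ++ (Γ ⊢ ex y B ∷ Δ) ∷ H)
  ∃r-images G H Γ Δ y B b ih σ e t≢ with focus-on G e
  ... | focus T₁ (Γ′ ⊢ Δ′) T₂ e₁ x e₂ with view∷ʳ x
  ... | kept Δ″ Δ′↭ x′ = perm-at T₁ T₂ (↭-refl , ↭-sym Δ′↭)
        (∃r T₁ T₂ Γ′ Δ″ y (rename σ B) (σ b)
          (subst (λ X → LNIF (T₁ ++ (Γ′ ⊢ X ∷ ex y (rename σ B) ∷ Δ″) ∷ T₂)) (rename-[/] σ B b y)
            (ih σ (e₁ ++ᴱ Step-addʳ (B [ b / y ] ∷ ex y B ∷ []) x′ ∷ e₂) t≢)))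

  lift-images : ∀ G H Γ₁ Δ₁ Γ₂ Δ₂ A → ImagesDerivable (G ++ (A ∷ Γ₁ ⊢ Δ₁) ∷ (A ∷ Γ₂ ⊢ Δ₂) ∷ H) →
                ImagesDerivable (G ++ (A ∷ Γ₁ ⊢ Δ₁) ∷ (Γ₂ ⊢ Δ₂) ∷ H)
  lift-images G H Γ₁ Δ₁ Γ₂ Δ₂ A ih σ e t≢ with focus-on G e
  ... | focus T₁ (Γ₁′ ⊢ Δ₁′) T₂ e₁ x₁ e₂ with focus-on [] e₂ | Step-∷ˡ⁻ x₁
  ... | focus M (Γ₂′ ⊢ Δ₂′) T₃ eM x₂ e₃ | Γ₁″ , Γ₁′↭ , x₁′ = perm-at T₁ _ (↭-sym Γ₁′↭ , ↭-refl)
        (lift* T₁ (rename σ A) Γ₁″ Δ₁′ M Γ₂′ Δ₂′ T₃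
          (ih σ (e₁ ++ᴱ Step-addˡ (A ∷ []) x₁′ ∷
                 Embedding-addˡ (rename σ A) eM ++ᴱ Step-addˡ (A ∷ []) x₂ ∷ e₃) t≢))

  ⊃r₁-images : ∀ G Γ Δ A B → ImagesDerivable (G ++ (Γ ⊢ Δ) ∷ (A ∷ [] ⊢ B ∷ []) ∷ []) →
               ImagesDerivable (G ++ (Γ ⊢ (A ⊃ B) ∷ Δ) ∷ [])
  ⊃r₁-images G Γ Δ A B ih σ e t≢ with focus-on G e
  ... | focus T₁ (Γ′ ⊢ Δ′) T₂ e₁ x e₂ with view∷ʳ x
  ... | kept Δ″ Δ′↭ x′ = perm-at T₁ T₂ (↭-refl , ↭-sym Δ′↭)
        (⊃r*.rule*₁ (rename σ A) (rename σ B) T₁ Γ′ Δ″ T₂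
          λ R₁ R₂ _ eq → ih σ (e₁ ++ᴱ x′ ∷ place R₁ R₂ eq (≼-rename σ (A ∷ []) (B ∷ [])) e₂) t≢)

  ⊃r₂-images : ∀ G H Γ₁ Δ₁ Γ₂ Δ₂ A B →
               ImagesDerivable (G ++ (Γ₁ ⊢ Δ₁) ∷ (A ∷ [] ⊢ B ∷ []) ∷ (Γ₂ ⊢ Δ₂) ∷ H) →
               ImagesDerivable (G ++ (Γ₁ ⊢ Δ₁) ∷ (Γ₂ ⊢ (A ⊃ B) ∷ Δ₂) ∷ H) →
               ImagesDerivable (G ++ (Γ₁ ⊢ (A ⊃ B) ∷ Δ₁) ∷ (Γ₂ ⊢ Δ₂) ∷ H)
  ⊃r₂-images G H Γ₁ Δ₁ Γ₂ Δ₂ A B ih₁ ih₂ σ e t≢ with focus-on G e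
  ... | focus T₁ (Γ₁′ ⊢ Δ₁′) T₂ e₁ x₁ e₂ with focus-on [] e₂ | view∷ʳ x₁
  ... | focus M (Γ₂′ ⊢ Δ₂′) T₃ eM x₂ e₃ | kept Δ₁″ Δ₁′↭ x₁′ = perm-at T₁ _ (↭-refl , ↭-sym Δ₁′↭)
        (⊃r*.rule*₂ (rename σ A) (rename σ B) T₁ Γ₁′ Δ₁″ M Γ₂′ Δ₂′ T₃
          (λ M₁ M₂ _ eq → ih₁ σ
            (e₁ ++ᴱ x₁′ ∷ place-before M₁ M₂ eq (≼-rename σ (A ∷ []) (B ∷ [])) eM (x₂ ∷ e₃)) t≢)
          (ih₂ σ (e₁ ++ᴱ x₁′ ∷ eM ++ᴱ Step-addʳ ((A ⊃ B) ∷ []) x₂ ∷ e₃) t≢))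

  ∀r₁-images : ∀ G Γ Δ y B c → c ∉ paramsS (G ++ (Γ ⊢ all y B ∷ Δ) ∷ []) →
               ImagesDerivable (G ++ (Γ ⊢ Δ) ∷ instance-component y B c ∷ []) →
               ImagesDerivable (G ++ (Γ ⊢ all y B ∷ Δ) ∷ [])
  ∀r₁-images G Γ Δ y B c c∉ ih σ e t≢ with focus-on G e | ∉paramsS⇒FreshC-at G _ [] c∉
  ... | focus T₁ (Γ′ ⊢ Δ′) T₂ e₁ x e₂ | fG , (c∉Γ , c∉B ∷ c∉Δ) , _ with view∷ʳ x
  ... | kept Δ″ Δ′↭ x′ = perm-at T₁ T₂ (↭-refl , ↭-sym Δ′↭)
        (∀r*.rule*₁ y (rename σ B) T₁ Γ′ Δ″ T₂
          λ R₁ R₂ d eq → ih (update σ c d)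
            (Embedding-update d fG e₁ ++ᴱ Step-update d (c∉Γ , c∉Δ) x′ ∷
             place R₁ R₂ eq (instance-≼ σ d y B c∉B ⊆ₘ-refl) e₂) t≢)
  ... | dropped .y .B b c≼ B[b/y]≡I with find-witness e₂ t≢
  ...   | witnessed R₁ Γw Δw R₂ eR₁ w eR₂ with after-final eR₂
  ...     | refl = ih (update σ c b)
            (Embedding-update b fG e₁ ++ᴱ keep (≼-update b c∉Γ c∉Δ c≼) ∷
             rename-[] (rephase eR₁) ++ᴱ keep (witness-≼ σ b y B c∉B B[b/y]≡I w) ∷
             rename-[] (rephase eR₂)) λ ()

  ∀r₂-images : ∀ G H Γ₁ Δ₁ Γ₂ Δ₂ y B c → c ∉ paramsS (G ++ (Γ₁ ⊢ all y B ∷ Δ₁) ∷ (Γ₂ ⊢ Δ₂) ∷ H) →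
               ImagesDerivable (G ++ (Γ₁ ⊢ Δ₁) ∷ instance-component y B c ∷ (Γ₂ ⊢ Δ₂) ∷ H) →
               ImagesDerivable (G ++ (Γ₁ ⊢ Δ₁) ∷ (Γ₂ ⊢ all y B ∷ Δ₂) ∷ H) →
               ImagesDerivable (G ++ (Γ₁ ⊢ all y B ∷ Δ₁) ∷ (Γ₂ ⊢ Δ₂) ∷ H)
  ∀r₂-images G H Γ₁ Δ₁ Γ₂ Δ₂ y B c c∉ ih₁ ih₂ σ e t≢
    with focus-on G e | ∉paramsS⇒FreshC-at G _ (_ ∷ H) c∉
  ... | focus T₁ (Γ₁′ ⊢ Δ₁′) T₂ e₁ x₁ e₂ | fG , (c∉Γ₁ , c∉B ∷ c∉Δ₁) , fH with view∷ʳ x₁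
  ... | kept Δ₁″ Δ₁′↭ x₁′ with focus-on [] e₂
  ...   | focus M (Γ₂′ ⊢ Δ₂′) T₃ eM x₂ e₃ = perm-at T₁ _ (↭-refl , ↭-sym Δ₁′↭)
          (∀r*.rule*₂ y (rename σ B) T₁ Γ₁′ Δ₁″ M Γ₂′ Δ₂′ T₃
            (λ M₁ M₂ d eq → ih₁ (update σ c d)
              (Embedding-update d fG e₁ ++ᴱ Step-update d (c∉Γ₁ , c∉Δ₁) x₁′ ∷
               place-before M₁ M₂ eq (instance-≼ σ d y B c∉B ⊆ₘ-refl) eM
                 (Embedding-update d fH (x₂ ∷ e₃))) t≢)
            (ih₂ σ (e₁ ++ᴱ x₁′ ∷ eM ++ᴱ Step-addʳ (all y B ∷ []) x₂ ∷ e₃) t≢))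
  -- The omitted ∀yB is principal.  If the witness comes before the next component, the new
  -- instance component is mapped onto it; otherwise ∀yB is omitted from the next component.
  ∀r₂-images G H Γ₁ Δ₁ Γ₂ Δ₂ y B c c∉ ih₁ ih₂ σ e t≢
    | focus T₁ (Γ₁′ ⊢ Δ₁′) T₂ e₁ x₁ e₂ | fG , (c∉Γ₁ , c∉B ∷ c∉Δ₁) , fH | dropped .y .B b c≼ B[b/y]≡I
    with witness-or-image e₂
  ...   | image-first R₁ D₂ T₃ eR₁ (keep c₂) e₃ =
    ih₂ σ (e₁ ++ᴱ keep c≼ ∷ rephase eR₁ ++ᴱ drop y B b ↭-refl c₂ B[b/y]≡I ∷ e₃) t≢
  ...   | witness-first (witnessed R₁ Γw Δw R₂ eR₁ w eR₂) with after-final eR₂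
  ...     | refl = ih₁ (update σ c b)
            (Embedding-update b fG e₁ ++ᴱ keep (≼-update b c∉Γ₁ c∉Δ₁ c≼) ∷
             rename-[] (rephase eR₁) ++ᴱ keep (witness-≼ σ b y B c∉B B[b/y]≡I w) ∷
             Embedding-update b fH (rephase eR₂)) λ ()

  id-embedding : ∀ S → Embedding id before before S S
  id-embedding [] = []
  id-embedding (C ∷ S) = keep (≼-id C) ∷ id-embedding S

  images-derivable : LNIF S → ImagesDerivable S
  images-derivable (perm S≈ d) = perm-images S≈ (images-derivable d)
  images-derivable (id₁ G H Γ Δ P ts) = id₁-images G H Γ Δ P ts
  images-derivable (id₂ G H F Γ₁ Δ₁ Γ₂ Δ₂ P ts) = id₂-images G H F Γ₁ Δ₁ Γ₂ Δ₂ P ts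
  images-derivable (⊥l G H Γ Δ) = ⊥l-images G H Γ Δ
  images-derivable (∧l G H Γ Δ A B d) = ∧l-images G H Γ Δ A B (images-derivable d)
  images-derivable (∨r G H Γ Δ A B d) = ∨r-images G H Γ Δ A B (images-derivable d)
  images-derivable (∧r G H Γ Δ A B d₁ d₂) =
    ∧r-images G H Γ Δ A B (images-derivable d₁) (images-derivable d₂)
  images-derivable (∨l G H Γ Δ A B d₁ d₂) =
    ∨l-images G H Γ Δ A B (images-derivable d₁) (images-derivable d₂)
  images-derivable (⊃r₁ G Γ Δ A B d) = ⊃r₁-images G Γ Δ A B (images-derivable d)
  images-derivable (⊃l G H Γ Δ A B d₁ d₂) =
    ⊃l-images G H Γ Δ A B (images-derivable d₁) (images-derivable d₂)
  images-derivable (lift G H Γ₁ Δ₁ Γ₂ Δ₂ A d) = lift-images G H Γ₁ Δ₁ Γ₂ Δ₂ A (images-derivable d)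
  images-derivable (∀l G H Γ Δ y B b d) = ∀l-images G H Γ Δ y B b (images-derivable d)
  images-derivable (∀r₁ G Γ Δ y B c c∉ d) = ∀r₁-images G Γ Δ y B c c∉ (images-derivable d)
  images-derivable (∃l G H Γ Δ y B c c∉ d) = ∃l-images G H Γ Δ y B c c∉ (images-derivable d)
  images-derivable (∃r G H Γ Δ y B b d) = ∃r-images G H Γ Δ y B b (images-derivable d)
  images-derivable (⊃r₂ G H Γ₁ Δ₁ Γ₂ Δ₂ A B d₁ d₂) =
    ⊃r₂-images G H Γ₁ Δ₁ Γ₂ Δ₂ A B (images-derivable d₁) (images-derivable d₂)
  images-derivable (∀r₂ G H Γ₁ Δ₁ Γ₂ Δ₂ y B c c∉ d₁ d₂) =
    ∀r₂-images G H Γ₁ Δ₁ Γ₂ Δ₂ y B c c∉ (images-derivable d₁) (images-derivable d₂)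

lemma13 : ∀ (G : LNS) (Γ Δ : List Formula) (x : BVar) (A : Formula) (a : Param) →
            ClosedS (G ++ (Γ ⊢ all x A ∷ Δ) ∷ []) →
            LNIF (G ++ (Γ ⊢ all x A ∷ Δ) ∷ []) →
            a ∉ paramsS (G ++ (Γ ⊢ all x A ∷ Δ) ∷ []) →
            LNIF (G ++ (Γ ⊢ Δ) ∷ ([] ⊢ A [ a / x ] ∷ []) ∷ [])
lemma13 G Γ Δ x A a _ d _ =
  images-derivable d id
    (id-embedding G ++ᴱ drop x A a ↭-refl (≼-id (Γ ⊢ Δ)) (cong (_[ a / x ]) (rename-id A)) ∷ witness (here refl) [])
    λ ()
  where open Inversion (A [ a / x ]) using (images-derivable; id-embedding; drop; witness; _∷_; []; _++ᴱ_)
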